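{- Let $r$, $l$, $m$ be positive integers with $l\ge 2$ and $m\ge 3$, let $G=P_l[K_{1,m,m,m}]$, and let $\delta$ and $\Delta$ denote the minimum and maximum degree of $G$. Then: (i) $\chi_r(G)=4$ for $1\le r\le 3$; (ii) for $4\le r\le \delta-1$, $\chi_r(G)=r+i$ for some integer $i\ge 2$; (iii) if $l=2$, then $\chi_r(G)=2(3m+1)$ for $\delta\le r\le \Delta$; (iv) if $l\neq 2$, then $\chi_r(G)=2(3m+1)$ for $r=\delta$; (v) if $l\neq 2$, then for $\delta+1\le r\le \Delta-m+1$, $\chi_r(G)=2(3m+1)+i$ for some positive integer $i$; (vi) if $l\ge 3$, then $\chi_r(G)=3(3m+1)$ for $\Delta-m+2\le r\le \Delta$.
   Context: All graphs are finite, simple, undirected. An $r$-dynamic $k$-coloring of a graph $G$ is a map $c:V(G)\to\{1,\dots,k\}$ such that $c(u)\neq c(v)$ for every edge $uv$, and for every vertex $v$, $|c(N(v))|\ge \min\{r,d(v)\}$, where $N(v)$ is the set of neighbours of $v$ and $d(v)$ its degree. The $r$-dynamic chromatic number $\chi_r(G)$ is the least $k$ for which an $r$-dynamic $k$-coloring exists. $P_l$ is the path on $l$ vertices. The triple star $K_{1,m,m,m}$ is the tree on $3m+1$ vertices consisting of a center adjacent to $m$ vertices $a_1,\dots,a_m$, where each $a_i$ is adjacent to a vertex $b_i$ which in turn is adjacent to a pendant vertex $c_i$ (so it has $3m$ edges; it is obtained from the double star by attaching one new pendant edge at each of its $m$ pendant vertices). The lexicographic product $G_1[G_2]$ has vertex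 set $V(G_1)\times V(G_2)$, with $(g,h)$ adjacent to $(g',h')$ iff $gg'\in E(G_1)$, or $g=g'$ and $hh'\in E(G_2)$. -}

module Defs where

open import Data.Nat using (ℕ; zero; suc; _+_; _*_; _⊓_; _⊔_; _≤_; _<_; _≡ᵇ_; _≤ᵇ_)
open import Data.Bool using (Bool; true; false; _∧_; _∨_; if_then_else_)
open import Data.Fin using (Fin; toℕ; remQuot; _≟_)
open import Data.Product using (_×_; proj₁; proj₂; ∃)
open import Function using (_∘_)
open import Relation.Nullary using (¬_)
open import Relation.Nullary.Decidable using (⌊_⌋)
open import Relation.Binary.PropositionalEquality using (_≡_; _≢_)

record Graph : Set where
  field
    size : ℕ
    adj  : Fin size → Fin size → Bool
open Graph public

count : ∀ {n} → (Fin n → Bool) → ℕ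
count {zero}  f = 0
count {suc n} f = (if f Data.Fin.zero then 1 else 0) + count (f ∘ Data.Fin.suc)

anyFin : ∀ {n} → (Fin n → Bool) → Bool
anyFin {zero}  f = false
anyFin {suc n} f = f Data.Fin.zero ∨ anyFin (f ∘ Data.Fin.suc)

minF : ∀ {n} → (Fin n → ℕ) → ℕ
minF {zero}        f = 0
minF {suc zero}    f = f Data.Fin.zero
minF {suc (suc n)} f = f Data.Fin.zero ⊓ minF (f ∘ Data.Fin.suc)

maxF : ∀ {n} → (Fin n → ℕ) → ℕ
maxF {zero}  f = 0
maxF {suc n} f = f Data.Fin.zero ⊔ maxF (f ∘ Data.Fin.suc)

deg : (G : Graph) → Fin (size G) → ℕ
deg G v = count (adj G v)

minDeg : Graph → ℕ
minDeg G = minF (deg G)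

maxDeg : Graph → ℕ
maxDeg G = maxF (deg G)

nbColours : (G : Graph) {k : ℕ} → (Fin (size G) → Fin k) → Fin (size G) → ℕ
nbColours G {k} c v = count {k} (λ j → anyFin (λ u → adj G v u ∧ ⌊ c u ≟ j ⌋))

IsRDynamicColouring : (G : Graph) (r k : ℕ) → (Fin (size G) → Fin k) → Set
IsRDynamicColouring G r k c =
  (∀ u v → adj G u v ≡ true → c u ≢ c v) ×
  (∀ v → r ⊓ deg G v ≤ nbColours G c v)

HasRDynamicColouring : (G : Graph) (r k : ℕ) → Set
HasRDynamicColouring G r k = ∃ λ (c : Fin (size G) → Fin k) → IsRDynamicColouring G r k c

ChiR≡ : (G : Graph) (r k : ℕ) → Set
ChiR≡ G r k = HasRDynamicColouring G r k × (∀ k′ → k′ < k → ¬ HasRDynamicColouring G r k′)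

infix 4 _==_
_==_ : ℕ → ℕ → Bool
a == b = a ≡ᵇ b

path : ℕ → Graph
path l = record { size = l ; adj = λ i j → (suc (toℕ i) == toℕ j) ∨ (suc (toℕ j) == toℕ i) }

-- Triple star K_{1,m,m,m} on vertices 0,…,3m:
--   0 = centre, 1+i = a_i, 1+m+i = b_i, 1+2m+i = c_i  (0 ≤ i < m)
tsEdge : ℕ → ℕ → ℕ → Bool
tsEdge m u v =
  ((u == 0) ∧ (1 ≤ᵇ v) ∧ (v ≤ᵇ m)) ∨
  ((1 ≤ᵇ u) ∧ (u ≤ᵇ 2 * m) ∧ (v == u + m))

tripleStar : ℕ → Graph
tripleStar m = record
  { size = 3 * m + 1
  ; adj  = λ u v → tsEdge m (toℕ u) (toℕ v) ∨ tsEdge m (toℕ v) (toℕ u) }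

lex : Graph → Graph → Graph
lex G₁ G₂ = record
  { size = size G₁ * size G₂
  ; adj  = λ x y →
      let p = remQuot (size G₂) x ; q = remQuot (size G₂) y in
      adj G₁ (proj₁ p) (proj₁ q) ∨
      (⌊ proj₁ p ≟ proj₁ q ⌋ ∧ adj G₂ (proj₂ p) (proj₂ q)) }

-- View P_l[K_{1,m,m,m}] as l layers, each a copy of the triple star T on N = 3m + 1 vertices, with
-- consecutive layers completely joined. Lower bounds: the leaf c₁ of T has the single neighbour b₁ in
-- its own layer, so around (0, c₁) and (1, c₁) every colour but one occurs on the layers adjacent to
-- 0, resp. 1; these are layer 1, resp. layers 0 and 2, which are completely joined to each other, so
-- the two colour sets are disjoint and min(r, d(0, c₁)) + min(r, d(1, c₁)) ≤ k + 2. Together with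
-- d(0, c₁) = N + 1, d(1, c₁) ≥ 2N + 1 (for l ≥ 3), δ ≥ N + 1 and Δ ≥ 2N + m this gives every lower
-- bound except χ_r ≥ 4, which comes from a K₄. Upper bounds come from product colourings
-- (colour of the layer, colour inside T): layer parity and the bipartition of T for (i), layer parity
-- and the identity for (iv), the layer mod 3 and the identity for (vi), which is injective on every
-- neighbourhood; the identity colouring gives (iii). In (ii) and (v), χ_r exists by exhaustive search.

module Submission where

open import Defs
open import Data.Nat using (ℕ; zero; suc; _+_; _*_; _∸_; _≤_; _<_; _⊓_; _≤ᵇ_; z≤n; s≤s; _≤?_)
open import Data.Nat.Properties hiding (_≟_)
import Data.Nat.Properties as ℕ
open import Data.Bool using (Bool; true; false; _∧_; _∨_; if_then_else_)
open import Data.Fin as Fin using (Fin; toℕ; fromℕ; fromℕ<; combine; quotient; remainder; splitAt; join; funToFin; finToFun; _≟_)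
open import Data.Fin.Patterns using (0F; 1F; 2F)
import Data.Fin.Properties as Finₚ
import Data.Bool.Properties as Boolₚ
open import Data.Vec.Functional using ([]; _∷_; _++_)
open import Data.Vec.Functional.Properties using (lookup-++ˡ; lookup-++ʳ)
open import Data.Product using (_×_; _,_; proj₁; proj₂; ∃)
open import Data.Sum using (_⊎_; inj₁; inj₂; [_,_])
open import Data.Empty using (⊥; ⊥-elim)
open import Function using (_∘_; id; Injective)
open import Relation.Nullary using (¬_; Dec; yes; no; does; ¬?; contradiction)
open import Relation.Nullary.Decidable using (⌊_⌋; map′; _×-dec_; _→-dec_; dec-true; dec-false; decidable-stable; isYes≗does; ⌊⌋-map′)
open import Relation.Binary.PropositionalEquality hiding ([_])
open import Data.Nat.Tactic.RingSolver using (solve-∀)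
open import Algebra.Properties.CommutativeSemigroup +-commutativeSemigroup using () renaming (interchange to +-interchange)

private
  variable
    n k : ℕ
    G : Graph

does⇒ : ∀ {A : Set} (a? : Dec A) → does a? ≡ true → A
does⇒ (yes a) _ = a

isYes⇒ : ∀ {A : Set} (a? : Dec A) → ⌊ a? ⌋ ≡ true → A
isYes⇒ a? e = does⇒ a? (trans (sym (isYes≗does a?)) e)

⇒isYes : ∀ {A : Set} (a? : Dec A) → A → ⌊ a? ⌋ ≡ true
⇒isYes a? a = trans (isYes≗does a?) (dec-true a? a)

∨-elim : ∀ {a b} → a ∨ b ≡ true → a ≡ true ⊎ b ≡ true
∨-elim {true}  _ = inj₁ refl
∨-elim {false} b = inj₂ b

∨-introˡ : ∀ {a b} → a ≡ true → a ∨ b ≡ true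
∨-introˡ refl = refl

∨-introʳ : ∀ {a b} → b ≡ true → a ∨ b ≡ true
∨-introʳ {true}  _ = refl
∨-introʳ {false} b = b

∧-elim : ∀ {a b} → a ∧ b ≡ true → a ≡ true × b ≡ true
∧-elim {true} b = refl , b

∧-intro : ∀ {a b} → a ≡ true → b ≡ true → a ∧ b ≡ true
∧-intro refl b = b

true≢false : true ≢ false
true≢false ()

-- Counting with Boolean predicates

count-cong : {f g : Fin n → Bool} → f ≗ g → count f ≡ count g
count-cong {zero}  _   = refl
count-cong {suc n} f≗g =
  cong₂ _+_ (cong (λ b → if b then 1 else 0) (f≗g 0F)) (count-cong (f≗g ∘ Fin.suc))

count-false : count {n} (λ _ → false) ≡ 0
count-false {zero}  = refl
count-false {suc n} = count-false {n}

count-true : count {n} (λ _ → true) ≡ n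
count-true {zero}  = refl
count-true {suc n} = cong suc (count-true {n})

count-≤ : (f : Fin n → Bool) → count f ≤ n
count-≤ {zero}  f = z≤n
count-≤ {suc n} f with f 0F
... | true  = s≤s (count-≤ (f ∘ Fin.suc))
... | false = m≤n⇒m≤1+n (count-≤ (f ∘ Fin.suc))

count-mono : (f g : Fin n → Bool) → (∀ j → f j ≡ true → g j ≡ true) → count f ≤ count g
count-mono {zero}  f g f⊆g = z≤n
count-mono {suc n} f g f⊆g with f 0F in f₀ | g 0F in g₀
... | true  | true  = s≤s (count-mono (f ∘ Fin.suc) (g ∘ Fin.suc) (f⊆g ∘ Fin.suc))
... | true  | false = contradiction (trans (sym (f⊆g 0F f₀)) g₀) true≢false
... | false | true  = m≤n⇒m≤1+n (count-mono (f ∘ Fin.suc) (g ∘ Fin.suc) (f⊆g ∘ Fin.suc))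
... | false | false = count-mono (f ∘ Fin.suc) (g ∘ Fin.suc) (f⊆g ∘ Fin.suc)

count-∨ : (f g : Fin n → Bool) → count (λ j → f j ∨ g j) ≤ count f + count g
count-∨ {zero}  f g = z≤n
count-∨ {suc n} f g with f 0F | g 0F
... | true  | true  = s≤s (≤-trans (count-∨ (f ∘ Fin.suc) (g ∘ Fin.suc)) (+-monoʳ-≤ (count (f ∘ Fin.suc)) (n≤1+n _)))
... | true  | false = s≤s (count-∨ (f ∘ Fin.suc) (g ∘ Fin.suc))
... | false | true  = ≤-trans (s≤s (count-∨ (f ∘ Fin.suc) (g ∘ Fin.suc))) (≤-reflexive (sym (+-suc _ _)))
... | false | false = count-∨ (f ∘ Fin.suc) (g ∘ Fin.suc)

Disjoint : (f g : Fin n → Bool) → Set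
Disjoint f g = ∀ j → f j ≡ true → g j ≡ true → ⊥

count-∨-disjoint : (f g : Fin n → Bool) → Disjoint f g → count f + count g ≤ count (λ j → f j ∨ g j)
count-∨-disjoint {zero}  f g f#g = z≤n
count-∨-disjoint {suc n} f g f#g with f 0F in f₀ | g 0F in g₀
... | true  | true  = ⊥-elim (f#g 0F f₀ g₀)
... | true  | false = s≤s (count-∨-disjoint (f ∘ Fin.suc) (g ∘ Fin.suc) (f#g ∘ Fin.suc))
... | false | true  = ≤-trans (≤-reflexive (+-suc _ _)) (s≤s (count-∨-disjoint (f ∘ Fin.suc) (g ∘ Fin.suc) (f#g ∘ Fin.suc)))
... | false | false = count-∨-disjoint (f ∘ Fin.suc) (g ∘ Fin.suc) (f#g ∘ Fin.suc)

count-singleton : (x : Fin n) → count (λ j → ⌊ x ≟ j ⌋) ≡ 1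
count-singleton {suc n} 0F    = cong suc (count-false {n})
count-singleton {suc n} (Fin.suc x) = trans (count-cong (λ j → ⌊⌋-map′ _ _ (x ≟ j))) (count-singleton x)

anyFin-intro : (f : Fin n → Bool) (u : Fin n) → f u ≡ true → anyFin f ≡ true
anyFin-intro f 0F    fu = ∨-introˡ fu
anyFin-intro f (Fin.suc u) fu = ∨-introʳ (anyFin-intro (f ∘ Fin.suc) u fu)

anyFin-elim : (f : Fin n → Bool) → anyFin f ≡ true → ∃ λ u → f u ≡ true
anyFin-elim {suc n} f any with ∨-elim {f 0F} any
... | inj₁ f₀ = 0F , f₀
... | inj₂ fs = let u , fu = anyFin-elim (f ∘ Fin.suc) fs in Fin.suc u , fu

anyFin-cong : {f g : Fin n → Bool} → f ≗ g → anyFin f ≡ anyFin g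
anyFin-cong {zero}  _   = refl
anyFin-cong {suc n} f≗g = cong₂ _∨_ (f≗g 0F) (anyFin-cong (f≗g ∘ Fin.suc))

-- nbColours G c v unfolds to count (image (adj G v) c).
image : (Fin n → Bool) → (Fin n → Fin k) → Fin k → Bool
image q c j = anyFin (λ u → q u ∧ ⌊ c u ≟ j ⌋)

InjectiveOn : {A : Set} → (Fin n → Bool) → (Fin n → A) → Set
InjectiveOn q c = ∀ {u v} → q u ≡ true → q v ≡ true → c u ≡ c v → u ≡ v

injectiveOn-tail : ∀ {A : Set} {q : Fin (suc n) → Bool} {c : Fin (suc n) → A} →
                   InjectiveOn q c → InjectiveOn (q ∘ Fin.suc) (c ∘ Fin.suc)
injectiveOn-tail inj qu qv eq = Finₚ.suc-injective (inj qu qv eq)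

count-∧-singleton : (b : Bool) (x : Fin k) → count (λ j → b ∧ ⌊ x ≟ j ⌋) ≤ (if b then 1 else 0)
count-∧-singleton {k} true  x = ≤-reflexive (count-singleton x)
count-∧-singleton {k} false x = ≤-reflexive (count-false {k})

count-image-≤ : (q : Fin n → Bool) (c : Fin n → Fin k) → count (image q c) ≤ count q
count-image-≤ {zero}  {k} q c = ≤-reflexive (count-false {k})
count-image-≤ {suc n}     q c =
  ≤-trans (count-∨ (λ j → q 0F ∧ ⌊ c 0F ≟ j ⌋) (image (q ∘ Fin.suc) (c ∘ Fin.suc)))
          (+-mono-≤ (count-∧-singleton (q 0F) (c 0F)) (count-image-≤ (q ∘ Fin.suc) (c ∘ Fin.suc)))

count-≤-image : (q : Fin n → Bool) (c : Fin n → Fin k) → InjectiveOn q c → count q ≤ count (image q c)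
count-≤-image {zero}  q c inj = z≤n
count-≤-image {suc n} q c inj with q 0F in q₀
... | false = count-≤-image (q ∘ Fin.suc) (c ∘ Fin.suc) (injectiveOn-tail inj)
... | true = begin
  suc (count (q ∘ Fin.suc))                  ≤⟨ s≤s (count-≤-image (q ∘ Fin.suc) (c ∘ Fin.suc) (injectiveOn-tail inj)) ⟩
  suc (count rest)                           ≡⟨ cong (_+ count rest) (count-singleton (c 0F)) ⟨
  count (λ j → ⌊ c 0F ≟ j ⌋) + count rest    ≤⟨ count-∨-disjoint _ rest fresh ⟩
  count (λ j → ⌊ c 0F ≟ j ⌋ ∨ rest j)        ∎
  where
  open ≤-Reasoning
  rest = image (q ∘ Fin.suc) (c ∘ Fin.suc)
  fresh : Disjoint (λ j → ⌊ c 0F ≟ j ⌋) rest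
  fresh j c₀≡j in-rest with anyFin-elim _ in-rest
  ... | u , qu∧cu≡j with ∧-elim {q (Fin.suc u)} qu∧cu≡j
  ... | qu , cu≡j with () ← inj qu q₀ (trans (isYes⇒ (_ ≟ j) cu≡j) (sym (isYes⇒ (_ ≟ j) c₀≡j)))

injective⇒≤count : (p : Fin k → Bool) (e : Fin n → Fin k) →
                   Injective _≡_ _≡_ e → (∀ i → p (e i) ≡ true) → n ≤ count p
injective⇒≤count {k} {n} p e inj p∘e = begin
  n                           ≡⟨ count-true {n} ⟨
  count {n} (λ _ → true)      ≤⟨ count-≤-image (λ _ → true) e (λ _ _ → inj) ⟩
  count (image (λ _ → true) e) ≤⟨ count-mono _ p in-p ⟩
  count p                     ∎
  where
  open ≤-Reasoning
  in-p : ∀ j → image (λ _ → true) e j ≡ true → p j ≡ true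
  in-p j hit with i , ei≡j ← anyFin-elim _ hit = subst (λ x → p x ≡ true) (isYes⇒ (e i ≟ j) ei≡j) (p∘e i)

covering⇒count≤ : (p : Fin k → Bool) (e : Fin n → Fin k) →
                  (∀ j → p j ≡ true → ∃ λ i → e i ≡ j) → count p ≤ n
covering⇒count≤ {k} {n} p e cover = begin
  count p                       ≤⟨ count-mono p _ in-image ⟩
  count (image (λ _ → true) e)  ≤⟨ count-image-≤ (λ _ → true) e ⟩
  count {n} (λ _ → true)        ≡⟨ count-true {n} ⟩
  n                             ∎
  where
  open ≤-Reasoning
  in-image : ∀ j → p j ≡ true → image (λ _ → true) e j ≡ true
  in-image j pj with i , ei≡j ← cover j pj = anyFin-intro _ i (⇒isYes (e i ≟ j) ei≡j)

≤-minF : (f : Fin n → ℕ) {b : ℕ} → Fin n → (∀ i → b ≤ f i) → b ≤ minF f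
≤-minF {suc zero}    f _ b≤f = b≤f 0F
≤-minF {suc (suc n)} f _ b≤f = ⊓-glb (b≤f 0F) (≤-minF (f ∘ Fin.suc) 0F (b≤f ∘ Fin.suc))

minF-≤ : (f : Fin n → ℕ) (i : Fin n) → minF f ≤ f i
minF-≤ {suc zero}    f 0F    = ≤-refl
minF-≤ {suc (suc n)} f 0F    = m⊓n≤m _ _
minF-≤ {suc (suc n)} f (Fin.suc i) = ≤-trans (m⊓n≤n _ _) (minF-≤ (f ∘ Fin.suc) i)

≤-maxF : (f : Fin n → ℕ) (i : Fin n) → f i ≤ maxF f
≤-maxF {suc n} f 0F    = m≤m⊔n _ _
≤-maxF {suc n} f (Fin.suc i) = ≤-trans (≤-maxF (f ∘ Fin.suc) i) (m≤n⊔m _ _)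

Vertex : Graph → Set
Vertex G = Fin (size G)

Proper : (G : Graph) → (Vertex G → Fin k) → Set
Proper G c = ∀ u v → adj G u v ≡ true → c u ≢ c v

Irreflexive : Graph → Set
Irreflexive G = ∀ u → adj G u u ≢ true

Symmetric : Graph → Set
Symmetric G = ∀ u v → adj G u v ≡ adj G v u

NoIsolatedVertex : Graph → Set
NoIsolatedVertex G = ∀ u → ∃ λ v → adj G u v ≡ true

LocallyInjective : (G : Graph) → (Vertex G → Fin k) → Set
LocallyInjective G c = ∀ v → InjectiveOn (adj G v) c

IsClique : (G : Graph) → (Fin n → Vertex G) → Set
IsClique G e = ∀ {i j} → i ≢ j → adj G (e i) (e j) ≡ true

id-proper : Irreflexive G → Proper G id
id-proper irr u .u uu refl = irr u uu

deg-≥ : (G : Graph) (v : Vertex G) (e : Fin n → Vertex G) →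
        (∀ i → adj G v (e i) ≡ true) → Injective _≡_ _≡_ e → n ≤ deg G v
deg-≥ G v e v~e inj = injective⇒≤count (adj G v) e inj v~e

deg-≤ : (G : Graph) (v : Vertex G) (e : Fin n → Vertex G) →
        (∀ u → adj G v u ≡ true → ∃ λ i → e i ≡ u) → deg G v ≤ n
deg-≤ G v e cover = covering⇒count≤ (adj G v) e cover

nbColours-≥ : (G : Graph) (c : Vertex G → Fin k) (v : Vertex G) (e : Fin n → Vertex G) →
              (∀ i → adj G v (e i) ≡ true) → Injective _≡_ _≡_ (c ∘ e) → n ≤ nbColours G c v
nbColours-≥ G c v e v~e inj =
  injective⇒≤count (image (adj G v) c) (c ∘ e) inj
    (λ i → anyFin-intro _ (e i) (∧-intro (v~e i) (⇒isYes (c (e i) ≟ c (e i)) refl)))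

locallyInjective⇒dynamic : (c : Vertex G → Fin k) → Proper G c → LocallyInjective G c →
                           ∀ r → IsRDynamicColouring G r k c
locallyInjective⇒dynamic {G = G} c proper injective r =
  proper , λ v → ≤-trans (m⊓n≤n r (deg G v)) (count-≤-image (adj G v) c (injective v))

clique-injective : (e : Fin n → Vertex G) (c : Vertex G → Fin k) →
                   IsClique G e → Proper G c → Injective _≡_ _≡_ (c ∘ e)
clique-injective e c clique proper {i} {j} ci≡cj with i ≟ j
... | yes i≡j = i≡j
... | no  i≢j = contradiction ci≡cj (proper _ _ (clique i≢j))

clique⇒≤colours : ∀ {r} (e : Fin n → Vertex G) → IsClique G e → HasRDynamicColouring G r k → n ≤ k
clique⇒≤colours e clique (c , proper , _) = Finₚ.injective⇒≤ (clique-injective e c clique proper)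

edge-clique : Symmetric G → ∀ {u v} → adj G u v ≡ true → IsClique G (u ∷ v ∷ [])
edge-clique _         u~v {0F} {0F} 0≢0 = contradiction refl 0≢0
edge-clique _         u~v {0F} {1F} _   = u~v
edge-clique symmetric u~v {1F} {0F} _   = trans (symmetric _ _) u~v
edge-clique _         u~v {1F} {1F} 1≢1 = contradiction refl 1≢1

isRDynamic-resp-≗ : ∀ {r} {c c′ : Vertex G → Fin k} → c ≗ c′ →
                    IsRDynamicColouring G r k c → IsRDynamicColouring G r k c′
isRDynamic-resp-≗ {G = G} {r = r} {c} {c′} c≗c′ (proper , dynamic) =
  (λ u v u~v c′u≡c′v → proper u v u~v (trans (c≗c′ u) (trans c′u≡c′v (sym (c≗c′ v))))) ,
  (λ v → subst (r ⊓ deg G v ≤_) (same-colours v) (dynamic v))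
  where
  same-colours : ∀ v → nbColours G c v ≡ nbColours G c′ v
  same-colours v = count-cong λ j → anyFin-cong λ u → cong (λ x → adj G v u ∧ ⌊ x ≟ j ⌋) (c≗c′ u)

isRDynamic? : ∀ G r k (c : Vertex G → Fin k) → Dec (IsRDynamicColouring G r k c)
isRDynamic? G r k c =
  Finₚ.all? (λ u → Finₚ.all? λ v → (adj G u v Boolₚ.≟ true) →-dec ¬? (c u ≟ c v)) ×-dec
  Finₚ.all? (λ v → r ⊓ deg G v ≤? nbColours G c v)

hasRDynamic? : ∀ G r k → Dec (HasRDynamicColouring G r k)
hasRDynamic? G r k =
  map′ (λ (i , dyn) → finToFun i , dyn)
       (λ (c , dyn) → funToFin c , isRDynamic-resp-≗ (sym ∘ Finₚ.finToFun-funToFin c) dyn)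
       (Finₚ.any? λ i → isRDynamic? G r k (finToFun i))

least-witness : {P : ℕ → Set} → (∀ n → Dec (P n)) → P n → ∃ λ k → P k × (∀ k′ → k′ < k → ¬ P k′)
least-witness {n = n} {P} P? pn
  with i , ¬¬pi , below ← Finₚ.¬∀⟶∃¬-smallest (suc n) (¬_ ∘ P ∘ toℕ) (¬? ∘ P? ∘ toℕ)
                            (λ none → none (fromℕ n) (subst P (sym (Finₚ.toℕ-fromℕ n)) pn))
  = toℕ i , decidable-stable (P? (toℕ i)) ¬¬pi , not-below
  where
  not-below : ∀ k′ → k′ < toℕ i → ¬ P k′
  not-below k′ k′<i = subst (¬_ ∘ P) (trans (Finₚ.toℕ-inject (fromℕ< k′<i)) (Finₚ.toℕ-fromℕ< k′<i))
                            (below (fromℕ< k′<i))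

χ-exists : ∀ {r} → HasRDynamicColouring G r k → ∃ (ChiR≡ G r)
χ-exists {G = G} {r = r} = least-witness (hasRDynamic? G r)

χ-≥ : ∀ {r a b} → HasRDynamicColouring G r k → (∀ {k′} → HasRDynamicColouring G r k′ → a + b ≤ k′) →
      ∃ λ i → a ≤ i × ChiR≡ G r (b + i)
χ-≥ {G = G} {r = r} {a} {b} colourable lower with χ-exists colourable
... | k , χ≡k@(has , _) =
  k ∸ b , m+n≤o⇒m≤o∸n a (lower has) ,
  subst (ChiR≡ G r) (sym (m+[n∸m]≡n (m+n≤o⇒n≤o a (lower has)))) χ≡k

singleton-injective : ∀ {A : Set} {x : A} → Injective _≡_ _≡_ (x ∷ [])
singleton-injective {_} {_} {0F} {0F} _ = refl

pair-injective : ∀ {A : Set} {x y : A} → x ≢ y → Injective _≡_ _≡_ (x ∷ y ∷ [])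
pair-injective x≢y {0F} {0F} _  = refl
pair-injective x≢y {0F} {1F} eq = contradiction eq x≢y
pair-injective x≢y {1F} {0F} eq = contradiction (sym eq) x≢y
pair-injective x≢y {1F} {1F} _  = refl

++-injective : ∀ {A : Set} {a b} {xs : Fin a → A} {ys : Fin b → A} →
               Injective _≡_ _≡_ xs → Injective _≡_ _≡_ ys → (∀ i j → xs i ≢ ys j) →
               Injective _≡_ _≡_ (xs ++ ys)
++-injective {a = a} {b} {xs} {ys} xs-inj ys-inj apart {i} {j} eq = begin
  i                      ≡⟨ Finₚ.join-splitAt a b i ⟨
  join a b (splitAt a i) ≡⟨ cong (join a b) (halves-injective (splitAt a i) (splitAt a j) eq) ⟩
  join a b (splitAt a j) ≡⟨ Finₚ.join-splitAt a b j ⟩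
  j                      ∎
  where
  open ≡-Reasoning
  halves-injective : ∀ x y → [ xs , ys ] x ≡ [ xs , ys ] y → x ≡ y
  halves-injective (inj₁ x) (inj₁ y) eq = cong inj₁ (xs-inj eq)
  halves-injective (inj₁ x) (inj₂ y) eq = contradiction eq (apart x y)
  halves-injective (inj₂ x) (inj₁ y) eq = contradiction (sym eq) (apart y x)
  halves-injective (inj₂ x) (inj₂ y) eq = cong inj₂ (ys-inj eq)

++-all : ∀ {A : Set} {a b} (P : A → Set) {xs : Fin a → A} {ys : Fin b → A} →
         (∀ i → P (xs i)) → (∀ j → P (ys j)) → ∀ i → P ((xs ++ ys) i)
++-all {a = a} P all-xs all-ys i with splitAt a i
... | inj₁ x = all-xs x
... | inj₂ y = all-ys y

_⊗_ : ∀ {a b n₁ n₂} → (Fin a → Fin n₁) → (Fin b → Fin n₂) → Fin (a * b) → Fin (n₁ * n₂)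
_⊗_ {a} {b} f g i = combine (f (quotient b i)) (g (remainder {a} b i))

⊗-combine : ∀ {a b n₁ n₂} (f : Fin a → Fin n₁) (g : Fin b → Fin n₂) x y →
            (f ⊗ g) (combine x y) ≡ combine (f x) (g y)
⊗-combine {a} {b} f g x y =
  cong (λ (x′ , y′) → combine (f x′) (g y′)) (Finₚ.remQuot-combine {a} {b} x y)

⊗-combine-injective : ∀ {a b n₁ n₂} (f : Fin a → Fin n₁) (g : Fin b → Fin n₂) {x x′ y y′} →
                      (f ⊗ g) (combine x y) ≡ (f ⊗ g) (combine x′ y′) → f x ≡ f x′ × g y ≡ g y′
⊗-combine-injective f g {x} {x′} {y} {y′} eq =
  Finₚ.combine-injective (f x) (g y) (f x′) (g y′)
    (trans (sym (⊗-combine f g x y)) (trans eq (⊗-combine f g x′ y′)))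

data LexView {n₁ n₂ : ℕ} : Fin (n₁ * n₂) → Set where
  ⟨_,_⟩ : (g : Fin n₁) (h : Fin n₂) → LexView (combine g h)

lexView : ∀ {n₁ n₂} (u : Fin (n₁ * n₂)) → LexView u
lexView {n₁} {n₂} u =
  subst (LexView {n₁} {n₂}) (Finₚ.combine-remQuot {n₁} n₂ u) ⟨ quotient {n₁} n₂ u , remainder {n₁} n₂ u ⟩

⊗-all : ∀ {a b n₁ n₂} (P : Fin (n₁ * n₂) → Set) (f : Fin a → Fin n₁) (g : Fin b → Fin n₂) →
        (∀ x y → P (combine (f x) (g y))) → ∀ i → P ((f ⊗ g) i)
⊗-all {a} {b} P f g p i = go (lexView {a} {b} i)
  where
  go : ∀ {i} → LexView {a} {b} i → P ((f ⊗ g) i)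
  go ⟨ x , y ⟩ = subst P (sym (⊗-combine f g x y)) (p x y)

⊗-injective : ∀ {a b n₁ n₂} {f : Fin a → Fin n₁} {g : Fin b → Fin n₂} →
              Injective _≡_ _≡_ f → Injective _≡_ _≡_ g → Injective _≡_ _≡_ (f ⊗ g)
⊗-injective {a} {b} {f = f} {g} f-inj g-inj {i} {j} = go (lexView {a} {b} i) (lexView {a} {b} j)
  where
  go : ∀ {i j} → LexView {a} {b} i → LexView {a} {b} j → (f ⊗ g) i ≡ (f ⊗ g) j → i ≡ j
  go ⟨ x , y ⟩ ⟨ x′ , y′ ⟩ eq =
    let fx≡fx′ , gy≡gy′ = ⊗-combine-injective f g eq in cong₂ combine (f-inj fx≡fx′) (g-inj gy≡gy′)

-- Lexicographic products

module _ {G₁ G₂ : Graph} where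

  private
    View = LexView {size G₁} {size G₂}
    view = lexView {size G₁} {size G₂}

  lex-adj : ∀ g g′ h h′ →
            adj (lex G₁ G₂) (combine g h) (combine g′ h′) ≡ (adj G₁ g g′ ∨ (⌊ g ≟ g′ ⌋ ∧ adj G₂ h h′))
  lex-adj g g′ h h′ =
    cong₂ (λ (x , y) (x′ , y′) → adj G₁ x x′ ∨ (⌊ x ≟ x′ ⌋ ∧ adj G₂ y y′))
          (Finₚ.remQuot-combine {size G₁} {size G₂} g h) (Finₚ.remQuot-combine {size G₁} {size G₂} g′ h′)

  lex-adj-between : ∀ {g g′} → adj G₁ g g′ ≡ true → ∀ h h′ → adj (lex G₁ G₂) (combine g h) (combine g′ h′) ≡ true
  lex-adj-between {g} {g′} g~g′ h h′ = trans (lex-adj g g′ h h′) (∨-introˡ g~g′)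

  lex-adj-within : ∀ g {h h′} → adj G₂ h h′ ≡ true → adj (lex G₁ G₂) (combine g h) (combine g h′) ≡ true
  lex-adj-within g {h} {h′} h~h′ =
    trans (lex-adj g g h h′) (∨-introʳ (∧-intro (⇒isYes (g ≟ g) refl) h~h′))

  lex-adj⁻¹ : ∀ {g g′ h h′} → adj (lex G₁ G₂) (combine g h) (combine g′ h′) ≡ true →
              adj G₁ g g′ ≡ true ⊎ (g ≡ g′ × adj G₂ h h′ ≡ true)
  lex-adj⁻¹ {g} {g′} {h} {h′} u~v with ∨-elim {adj G₁ g g′} (trans (sym (lex-adj g g′ h h′)) u~v)
  ... | inj₁ g~g′   = inj₁ g~g′
  ... | inj₂ within = let g≡g′ , h~h′ = ∧-elim within in inj₂ (isYes⇒ (g ≟ g′) g≡g′ , h~h′)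

  lex-irreflexive : Irreflexive G₁ → Irreflexive G₂ → Irreflexive (lex G₁ G₂)
  lex-irreflexive irr₁ irr₂ u = loopless (view u)
    where
    loopless : ∀ {u} → View u → adj (lex G₁ G₂) u u ≢ true
    loopless ⟨ g , h ⟩ u~u with lex-adj⁻¹ u~u
    ... | inj₁ g~g        = irr₁ g g~g
    ... | inj₂ (_ , h~h) = irr₂ h h~h

  lex-clique : ∀ {a b} {e₁ : Fin a → Vertex G₁} {e₂ : Fin b → Vertex G₂} →
               IsClique G₁ e₁ → IsClique G₂ e₂ → IsClique (lex G₁ G₂) (e₁ ⊗ e₂)
  lex-clique {a} {b} {e₁} {e₂} clique₁ clique₂ {i} {j} = adjacent (lexView {a} {b} i) (lexView {a} {b} j)
    where
    adjacent : ∀ {i j} → LexView {a} {b} i → LexView {a} {b} j → i ≢ j →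
               adj (lex G₁ G₂) ((e₁ ⊗ e₂) i) ((e₁ ⊗ e₂) j) ≡ true
    adjacent ⟨ x , y ⟩ ⟨ x′ , y′ ⟩ i≢j
      rewrite ⊗-combine e₁ e₂ x y | ⊗-combine e₁ e₂ x′ y′ with x ≟ x′
    ... | no  x≢x′ = lex-adj-between (clique₁ x≢x′) _ _
    ... | yes refl = lex-adj-within (e₁ x) (clique₂ λ y≡y′ → i≢j (cong (combine x) y≡y′))

  ⊗-proper : ∀ {p q} {φ : Vertex G₁ → Fin p} {ψ : Vertex G₂ → Fin q} →
             Proper G₁ φ → Proper G₂ ψ → Proper (lex G₁ G₂) (φ ⊗ ψ)
  ⊗-proper {φ = φ} {ψ} proper₁ proper₂ u v = proper (view u) (view v)
    where
    proper : ∀ {u v} → View u → View v → adj (lex G₁ G₂) u v ≡ true → (φ ⊗ ψ) u ≢ (φ ⊗ ψ) v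
    proper ⟨ g , h ⟩ ⟨ g′ , h′ ⟩ u~v same with ⊗-combine-injective φ ψ same | lex-adj⁻¹ u~v
    ... | φg≡φg′ , _ | inj₁ g~g′          = proper₁ g g′ g~g′ φg≡φg′
    ... | _ , ψh≡ψh′ | inj₂ (refl , h~h′) = proper₂ h h′ h~h′ ψh≡ψh′

  lex-deg-≥ : Irreflexive G₁ → ∀ {a b g h} (e₁ : Fin a → Vertex G₁) (e₂ : Fin b → Vertex G₂) →
              (∀ i → adj G₁ g (e₁ i) ≡ true) → Injective _≡_ _≡_ e₁ →
              (∀ j → adj G₂ h (e₂ j) ≡ true) → Injective _≡_ _≡_ e₂ →
              a * size G₂ + b ≤ deg (lex G₁ G₂) (combine g h)
  lex-deg-≥ irr₁ {a} {b} {g} {h} e₁ e₂ g~e₁ e₁-inj h~e₂ e₂-inj =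
    deg-≥ (lex G₁ G₂) (combine g h) family adjacent injective
    where
    family : Fin (a * size G₂ + b) → Vertex (lex G₁ G₂)
    family = (e₁ ⊗ id) ++ (combine g ∘ e₂)
    Adjacent : Vertex (lex G₁ G₂) → Set
    Adjacent u = adj (lex G₁ G₂) (combine g h) u ≡ true
    adjacent : ∀ i → Adjacent (family i)
    adjacent = ++-all Adjacent (⊗-all Adjacent e₁ id λ x y → lex-adj-between (g~e₁ x) h y)
                               (λ j → lex-adj-within g (h~e₂ j))
    other-layer : ∀ x y j → combine (e₁ x) y ≢ combine g (e₂ j)
    other-layer x y j eq with refl ← Finₚ.combine-injectiveˡ (e₁ x) y g (e₂ j) eq = irr₁ g (g~e₁ x)
    injective : Injective _≡_ _≡_ family
    injective = ++-injective (⊗-injective e₁-inj id) (e₂-inj ∘ Finₚ.combine-injectiveʳ g _ g _)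
                             (⊗-all (λ u → ∀ j → u ≢ combine g (e₂ j)) e₁ id other-layer)

  lex-deg-≤ : ∀ {a b g h} (e₁ : Fin a → Vertex G₁) (e₂ : Fin b → Vertex G₂) →
              (∀ g′ → adj G₁ g g′ ≡ true → ∃ λ i → e₁ i ≡ g′) →
              (∀ h′ → adj G₂ h h′ ≡ true → ∃ λ j → e₂ j ≡ h′) →
              deg (lex G₁ G₂) (combine g h) ≤ a * size G₂ + b
  lex-deg-≤ {a} {b} {g} {h} e₁ e₂ cover₁ cover₂ =
    deg-≤ (lex G₁ G₂) (combine g h) ((e₁ ⊗ id) ++ (combine g ∘ e₂)) λ u → cover (view u)
    where
    cover : ∀ {u} → View u → adj (lex G₁ G₂) (combine g h) u ≡ true →
            ∃ λ i → ((e₁ ⊗ id) ++ (combine g ∘ e₂)) i ≡ u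
    cover ⟨ g′ , h′ ⟩ g~u with lex-adj⁻¹ g~u
    ... | inj₁ g~g′ =
      let i , e₁i≡g′ = cover₁ g′ g~g′ in
      combine i h′ Fin.↑ˡ b ,
      trans (lookup-++ˡ (e₁ ⊗ id) _ (combine i h′))
            (trans (⊗-combine e₁ id i h′) (cong (λ x → combine x h′) e₁i≡g′))
    ... | inj₂ (refl , h~h′) =
      let j , e₂j≡h′ = cover₂ h′ h~h′ in
      a * size G₂ Fin.↑ʳ j , trans (lookup-++ʳ (e₁ ⊗ id) _ j) (cong (combine g) e₂j≡h′)

  ⊗-nbColours-≥ : ∀ {p q m} {φ : Vertex G₁ → Fin p} {ψ : Vertex G₂ → Fin q} → Proper G₁ φ →
                  ∀ {g g′ h h′} → adj G₁ g g′ ≡ true → adj G₂ h h′ ≡ true →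
                  (e : Fin m → Vertex G₂) → Injective _≡_ _≡_ (ψ ∘ e) →
                  suc m ≤ nbColours (lex G₁ G₂) (φ ⊗ ψ) (combine g h)
  ⊗-nbColours-≥ {φ = φ} {ψ} proper₁ {g} {g′} {h} {h′} g~g′ h~h′ e ψ∘e-inj =
    nbColours-≥ (lex G₁ G₂) (φ ⊗ ψ) (combine g h) family adjacent injective
    where
    family : Fin (suc _) → Vertex (lex G₁ G₂)
    family = combine g h′ ∷ (combine g′ ∘ e)
    adjacent : ∀ i → adj (lex G₁ G₂) (combine g h) (family i) ≡ true
    adjacent 0F          = lex-adj-within g h~h′
    adjacent (Fin.suc i) = lex-adj-between g~g′ h (e i)
    other-layer : ∀ i → (φ ⊗ ψ) (combine g h′) ≢ (φ ⊗ ψ) (combine g′ (e i))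
    other-layer i eq = proper₁ g g′ g~g′ (proj₁ (⊗-combine-injective φ ψ eq))
    injective : Injective _≡_ _≡_ ((φ ⊗ ψ) ∘ family)
    injective {0F}        {0F}        _  = refl
    injective {0F}        {Fin.suc j} eq = contradiction eq (other-layer j)
    injective {Fin.suc i} {0F}        eq = contradiction (sym eq) (other-layer i)
    injective {Fin.suc i} {Fin.suc j} eq = cong Fin.suc (ψ∘e-inj (proj₂ (⊗-combine-injective φ ψ eq)))

  ⊗-dynamic : ∀ {p q m r} {φ : Vertex G₁ → Fin p} {ψ : Vertex G₂ → Fin q} →
              NoIsolatedVertex G₁ → NoIsolatedVertex G₂ → Proper G₁ φ → Proper G₂ ψ →
              (e : Fin m → Vertex G₂) → Injective _≡_ _≡_ (ψ ∘ e) → r ≤ suc m →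
              IsRDynamicColouring (lex G₁ G₂) r (p * q) (φ ⊗ ψ)
  ⊗-dynamic {r = r} {φ} {ψ} isolated-free₁ isolated-free₂ proper₁ proper₂ e ψ∘e-inj r≤1+m =
    ⊗-proper proper₁ proper₂ , λ v → dynamic (view v)
    where
    dynamic : ∀ {v} → View v → r ⊓ deg (lex G₁ G₂) v ≤ nbColours (lex G₁ G₂) (φ ⊗ ψ) v
    dynamic ⟨ g , h ⟩ =
      ≤-trans (m⊓n≤m r _)
        (≤-trans r≤1+m (⊗-nbColours-≥ {ψ = ψ} proper₁ (proj₂ (isolated-free₁ g)) (proj₂ (isolated-free₂ h))
                                      e ψ∘e-inj))

  ⊗-locallyInjective : ∀ {p q} {φ : Vertex G₁ → Fin p} {ψ : Vertex G₂ → Fin q} →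
                       (∀ g → InjectiveOn (λ a → ⌊ g ≟ a ⌋ ∨ adj G₁ g a) φ) → Injective _≡_ _≡_ ψ →
                       LocallyInjective (lex G₁ G₂) (φ ⊗ ψ)
  ⊗-locallyInjective {φ = φ} {ψ} φ-inj ψ-inj v {u} {u′} = go (view v) (view u) (view u′)
    where
    closed : ∀ {g a x y} → adj (lex G₁ G₂) (combine g x) (combine a y) ≡ true → ⌊ g ≟ a ⌋ ∨ adj G₁ g a ≡ true
    closed {g} v~u with lex-adj⁻¹ v~u
    ... | inj₁ g~a        = ∨-introʳ g~a
    ... | inj₂ (refl , _) = ∨-introˡ (⇒isYes (g ≟ g) refl)
    go : ∀ {v u u′} → View v → View u → View u′ →
         adj (lex G₁ G₂) v u ≡ true → adj (lex G₁ G₂) v u′ ≡ true → (φ ⊗ ψ) u ≡ (φ ⊗ ψ) u′ → u ≡ u′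
    go ⟨ g , h ⟩ ⟨ a , x ⟩ ⟨ b , y ⟩ v~u v~u′ eq =
      let φa≡φb , ψx≡ψy = ⊗-combine-injective φ ψ eq in
      cong₂ combine (φ-inj g (closed v~u) (closed v~u′) φa≡φb) (ψ-inj ψx≡ψy)

  neighbourLayerColours : ∀ {k} → (Vertex (lex G₁ G₂) → Fin k) → Vertex G₁ → Fin k → Bool
  neighbourLayerColours c g j = anyFin λ u → adj G₁ g (quotient (size G₂) u) ∧ ⌊ c u ≟ j ⌋

  pendant-nbColours-≤ : ∀ {k} (c : Vertex (lex G₁ G₂) → Fin k) {h b} → (∀ {h′} → adj G₂ h h′ ≡ true → h′ ≡ b) →
                        ∀ g → nbColours (lex G₁ G₂) c (combine g h) ≤ count (neighbourLayerColours c g) + 1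
  pendant-nbColours-≤ c {h} {b} pendant g = begin
    nbColours (lex G₁ G₂) c (combine g h)                ≤⟨ count-mono _ _ seen ⟩
    count (λ j → near j ∨ ⌊ c (combine g b) ≟ j ⌋)       ≤⟨ count-∨ near _ ⟩
    count near + count (λ j → ⌊ c (combine g b) ≟ j ⌋)   ≡⟨ cong (count near +_) (count-singleton (c (combine g b))) ⟩
    count near + 1                                       ∎
    where
    open ≤-Reasoning
    near = neighbourLayerColours c g
    Seen : _ → Set
    Seen j = near j ∨ ⌊ c (combine g b) ≟ j ⌋ ≡ true
    via : ∀ {u} j → View u → adj (lex G₁ G₂) (combine g h) u ∧ ⌊ c u ≟ j ⌋ ≡ true → Seen j
    via j ⟨ g′ , h′ ⟩ g~u∧cu≡j with g~u , cu≡j ← ∧-elim g~u∧cu≡j with lex-adj⁻¹ g~u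
    ... | inj₁ g~g′ =
      ∨-introˡ (anyFin-intro _ (combine g′ h′)
        (∧-intro (subst (λ x → adj G₁ g x ≡ true) (sym (cong proj₁ (Finₚ.remQuot-combine g′ h′))) g~g′) cu≡j))
    ... | inj₂ (refl , h~h′) =
      ∨-introʳ {near j} (subst (λ x → ⌊ c (combine g x) ≟ j ⌋ ≡ true) (pendant h~h′) cu≡j)
    seen : ∀ j → image (adj (lex G₁ G₂) (combine g h)) c j ≡ true → Seen j
    seen j hit = let u , g~u∧cu≡j = anyFin-elim _ hit in via j (view u) g~u∧cu≡j

  neighbourLayerColours-disjoint :
    ∀ {k} {c : Vertex (lex G₁ G₂) → Fin k} → Proper (lex G₁ G₂) c →
    ∀ {g₀ g₁} → (∀ {a a′} → adj G₁ g₀ a ≡ true → adj G₁ g₁ a′ ≡ true → adj G₁ a a′ ≡ true) →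
    Disjoint (neighbourLayerColours c g₀) (neighbourLayerColours c g₁)
  neighbourLayerColours-disjoint {c = c} proper {g₀} {g₁} joined j near₀ near₁ =
    let u  , g₀~u∧cu≡j   = anyFin-elim _ near₀
        u′ , g₁~u′∧cu′≡j = anyFin-elim _ near₁
        g₀~u  , cu≡j  = ∧-elim {adj G₁ g₀ (quotient (size G₂) u)} g₀~u∧cu≡j
        g₁~u′ , cu′≡j = ∧-elim {adj G₁ g₁ (quotient (size G₂) u′)} g₁~u′∧cu′≡j
    in proper u u′ (∨-introˡ (joined g₀~u g₁~u′)) (trans (isYes⇒ (c u ≟ j) cu≡j) (sym (isYes⇒ (c u′ ≟ j) cu′≡j)))

  pendant-bound : ∀ {k} (c : Vertex (lex G₁ G₂) → Fin k) → Proper (lex G₁ G₂) c →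
                  ∀ {g₀ g₁} → (∀ {a a′} → adj G₁ g₀ a ≡ true → adj G₁ g₁ a′ ≡ true → adj G₁ a a′ ≡ true) →
                  ∀ {h b} → (∀ {h′} → adj G₂ h h′ ≡ true → h′ ≡ b) →
                  nbColours (lex G₁ G₂) c (combine g₀ h) + nbColours (lex G₁ G₂) c (combine g₁ h) ≤ k + 2
  pendant-bound {k} c proper {g₀} {g₁} joined pendant = begin
    nbColours (lex G₁ G₂) c (combine g₀ _) + nbColours (lex G₁ G₂) c (combine g₁ _)
      ≤⟨ +-mono-≤ (pendant-nbColours-≤ c pendant g₀) (pendant-nbColours-≤ c pendant g₁) ⟩
    (count near₀ + 1) + (count near₁ + 1)
      ≡⟨ +-interchange (count near₀) 1 (count near₁) 1 ⟩
    count near₀ + count near₁ + 2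
      ≤⟨ +-monoˡ-≤ 2 (≤-trans (count-∨-disjoint near₀ near₁ (neighbourLayerColours-disjoint proper joined))
                             (count-≤ _)) ⟩
    k + 2
      ∎
    where
    open ≤-Reasoning
    near₀ = neighbourLayerColours c g₀
    near₁ = neighbourLayerColours c g₁

-- Paths

path-adj : ∀ {l} (i j : Fin l) → toℕ j ≡ suc (toℕ i) ⊎ toℕ i ≡ suc (toℕ j) → adj (path l) i j ≡ true
path-adj i j (inj₁ j≡1+i) = ∨-introˡ (dec-true (suc (toℕ i) ℕ.≟ toℕ j) (sym j≡1+i))
path-adj i j (inj₂ i≡1+j) = ∨-introʳ (dec-true (suc (toℕ j) ℕ.≟ toℕ i) (sym i≡1+j))

path-adj⁻¹ : ∀ {l} (i j : Fin l) → adj (path l) i j ≡ true → toℕ j ≡ suc (toℕ i) ⊎ toℕ i ≡ suc (toℕ j)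
path-adj⁻¹ i j i~j with ∨-elim {suc (toℕ i) == toℕ j} i~j
... | inj₁ 1+i≡j = inj₁ (sym (does⇒ (suc (toℕ i) ℕ.≟ toℕ j) 1+i≡j))
... | inj₂ 1+j≡i = inj₂ (sym (does⇒ (suc (toℕ j) ℕ.≟ toℕ i) 1+j≡i))

path-symmetric : ∀ {l} → Symmetric (path l)
path-symmetric i j = Boolₚ.∨-comm (suc (toℕ i) == toℕ j) _

path-irreflexive : ∀ {l} → Irreflexive (path l)
path-irreflexive i i~i with path-adj⁻¹ i i i~i
... | inj₁ i≡1+i = 1+n≢n (sym i≡1+i)
... | inj₂ i≡1+i = 1+n≢n (sym i≡1+i)

path-noIsolatedVertex : ∀ {l} → NoIsolatedVertex (path (suc (suc l)))
path-noIsolatedVertex 0F          = 1F , refl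
path-noIsolatedVertex (Fin.suc i) = Fin.inject₁ i , path-adj _ _ (inj₂ (cong suc (sym (Finₚ.toℕ-inject₁ i))))

path-start-neighbour : ∀ {l} {i : Fin (suc (suc l))} → adj (path _) 0F i ≡ true → i ≡ 1F
path-start-neighbour {i = i} 0~i with path-adj⁻¹ 0F i 0~i
... | inj₁ i≡1 = Finₚ.toℕ-injective i≡1

path-start-joined : ∀ {l} {a a′ : Fin (suc (suc l))} →
                    adj (path _) 0F a ≡ true → adj (path _) 1F a′ ≡ true → adj (path _) a a′ ≡ true
path-start-joined {a = a} {a′} 0~a 1~a′ with refl ← path-start-neighbour {i = a} 0~a with path-adj⁻¹ _ a′ 1~a′
... | inj₁ a′≡2 = path-adj _ a′ (inj₁ a′≡2)
... | inj₂ 1≡1+a′ = path-adj _ a′ (inj₂ 1≡1+a′)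

parity : ℕ → Fin 2
parity zero    = 0F
parity (suc n) = Fin.opposite (parity n)

opposite-fixpoint-free : (x : Fin 2) → x ≢ Fin.opposite x
opposite-fixpoint-free 0F ()
opposite-fixpoint-free 1F ()

parity-proper : ∀ {l} → Proper (path l) (parity ∘ toℕ)
parity-proper i j i~j eq with path-adj⁻¹ i j i~j
... | inj₁ j≡1+i = opposite-fixpoint-free (parity (toℕ i)) (trans eq (cong parity j≡1+i))
... | inj₂ i≡1+j = opposite-fixpoint-free (parity (toℕ j)) (trans (sym eq) (cong parity i≡1+j))

rotate3 : Fin 3 → Fin 3
rotate3 0F = 1F
rotate3 1F = 2F
rotate3 2F = 0F

rotate3³ : ∀ x → rotate3 (rotate3 (rotate3 x)) ≡ x
rotate3³ 0F = refl
rotate3³ 1F = refl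
rotate3³ 2F = refl

residue3 : ℕ → Fin 3
residue3 zero    = 0F
residue3 (suc n) = rotate3 (residue3 n)

residue3-injective-≤2 : ∀ {a b} → a ≤ b → b ≤ 2 + a → residue3 a ≡ residue3 b → a ≡ b
residue3-injective-≤2 {zero}  {zero}                _ _                 _ = refl
residue3-injective-≤2 {zero}  {suc zero}            _ _                ()
residue3-injective-≤2 {zero}  {suc (suc zero)}      _ _                ()
residue3-injective-≤2 {zero}  {suc (suc (suc _))}   _ (s≤s (s≤s ())) _
residue3-injective-≤2 {suc a} {suc b} (s≤s a≤b) (s≤s b≤2+a) eq =
  cong suc (residue3-injective-≤2 a≤b b≤2+a (unrotate eq))
  where
  unrotate : ∀ {x y} → rotate3 x ≡ rotate3 y → x ≡ y
  unrotate {x} {y} eq = trans (sym (rotate3³ x)) (trans (cong (rotate3 ∘ rotate3) eq) (rotate3³ y))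

path-closedNeighbour : ∀ {l} {g a : Fin l} → ⌊ g ≟ a ⌋ ∨ adj (path l) g a ≡ true →
                       toℕ a ≤ suc (toℕ g) × toℕ g ≤ suc (toℕ a)
path-closedNeighbour {g = g} {a} g≈a with ∨-elim {⌊ g ≟ a ⌋} g≈a
... | inj₁ g≡a with refl ← isYes⇒ (g ≟ a) g≡a = n≤1+n _ , n≤1+n _
... | inj₂ g~a with path-adj⁻¹ g a g~a
...   | inj₁ a≡1+g = ≤-reflexive a≡1+g , m≤n⇒m≤1+n (≤-trans (n≤1+n _) (≤-reflexive (sym a≡1+g)))
...   | inj₂ g≡1+a = m≤n⇒m≤1+n (≤-trans (n≤1+n _) (≤-reflexive (sym g≡1+a))) , ≤-reflexive g≡1+a

residue3-closedInjective : ∀ {l} (g : Fin l) → InjectiveOn (λ a → ⌊ g ≟ a ⌋ ∨ adj (path l) g a) (residue3 ∘ toℕ)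
residue3-closedInjective g {a} {b} g≈a g≈b eq with path-closedNeighbour {g = g} g≈a | path-closedNeighbour {g = g} g≈b
... | a≤1+g , g≤1+a | b≤1+g , g≤1+b with ≤-total (toℕ a) (toℕ b)
...   | inj₁ a≤b = Finₚ.toℕ-injective (residue3-injective-≤2 a≤b (≤-trans b≤1+g (s≤s g≤1+a)) eq)
...   | inj₂ b≤a = Finₚ.toℕ-injective (sym (residue3-injective-≤2 b≤a (≤-trans a≤1+g (s≤s g≤1+b)) (sym eq)))

residue3-proper : ∀ {l} → Proper (path l) (residue3 ∘ toℕ)
residue3-proper {l} i j i~j eq =
  path-irreflexive i (subst (λ x → adj (path l) i x ≡ true) (sym i≡j) i~j)
  where i≡j = residue3-closedInjective {l} i (∨-introˡ (⇒isYes (i ≟ i) refl)) (∨-introʳ {⌊ i ≟ j ⌋} i~j) eq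

-- The triple star K_{1,m,m,m}

bit : Bool → Fin 2
bit false = 0F
bit true  = 1F

bit-injective : Injective _≡_ _≡_ bit
bit-injective {false} {false} _ = refl
bit-injective {true}  {true}  _ = refl

-- The edges in the numbering of Defs: spokes 0 – aᵢ and legs aᵢ – bᵢ, bᵢ – cᵢ, where aᵢ + m = bᵢ.
data TsEdge (m : ℕ) : ℕ → ℕ → Set where
  spoke : ∀ {v} → 1 ≤ v → v ≤ m → TsEdge m 0 v
  leg   : ∀ {u} → 1 ≤ u → u ≤ 2 * m → TsEdge m u (u + m)

tsEdge-sound : ∀ {m u v} → TsEdge m u v → tsEdge m u v ≡ true
tsEdge-sound {m} {v = v} (spoke 1≤v v≤m) =
  ∨-introˡ (∧-intro refl (∧-intro (dec-true (1 ≤? v) 1≤v) (dec-true (v ≤? m) v≤m)))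
tsEdge-sound {m} {u} (leg 1≤u u≤2m) =
  ∨-introʳ (∧-intro (dec-true (1 ≤? u) 1≤u)
                    (∧-intro (dec-true (u ≤? 2 * m) u≤2m) (dec-true (u + m ℕ.≟ u + m) refl)))

tsEdge-complete : ∀ {m u v} → tsEdge m u v ≡ true → TsEdge m u v
tsEdge-complete {m} {u} {v} u~v with ∨-elim {(u == 0) ∧ (1 ≤ᵇ v) ∧ (v ≤ᵇ m)} u~v
... | inj₁ centre with u≡0 , bounds ← ∧-elim {u == 0} centre with 1≤v , v≤m ← ∧-elim {1 ≤ᵇ v} bounds
                  with refl ← does⇒ (u ℕ.≟ 0) u≡0 = spoke (does⇒ (1 ≤? v) 1≤v) (does⇒ (v ≤? m) v≤m)
... | inj₂ outer with 1≤u , rest ← ∧-elim {1 ≤ᵇ u} outer with u≤2m , v≡u+m ← ∧-elim {u ≤ᵇ 2 * m} rest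
                 with refl ← does⇒ (v ℕ.≟ u + m) v≡u+m = leg (does⇒ (1 ≤? u) 1≤u) (does⇒ (u ≤? 2 * m) u≤2m)

TsEdge-irreflexive : ∀ {m u v} → TsEdge m u v → u ≢ v
TsEdge-irreflexive (spoke 1≤v _) refl = contradiction 1≤v λ ()
TsEdge-irreflexive {zero}  (leg 1≤u u≤0) _   = contradiction (≤-trans 1≤u u≤0) λ ()
TsEdge-irreflexive {suc m} (leg {u} _ _) eq = m≢1+m+n u (trans eq (+-suc u m))

module _ {m : ℕ} where

  ts-adj⁻¹ : ∀ u v → adj (tripleStar m) u v ≡ true → TsEdge m (toℕ u) (toℕ v) ⊎ TsEdge m (toℕ v) (toℕ u)
  ts-adj⁻¹ u v u~v with ∨-elim {tsEdge m (toℕ u) (toℕ v)} u~v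
  ... | inj₁ e = inj₁ (tsEdge-complete e)
  ... | inj₂ e = inj₂ (tsEdge-complete e)

  ts-symmetric : Symmetric (tripleStar m)
  ts-symmetric u v = Boolₚ.∨-comm (tsEdge m (toℕ u) (toℕ v)) _

  ts-irreflexive : Irreflexive (tripleStar m)
  ts-irreflexive u u~u with ts-adj⁻¹ u u u~u
  ... | inj₁ e = TsEdge-irreflexive e refl
  ... | inj₂ e = TsEdge-irreflexive e refl

  ts-adj-at : ∀ {u v x y} → TsEdge m x y → toℕ u ≡ x → toℕ v ≡ y → adj (tripleStar m) u v ≡ true
  ts-adj-at e refl refl = ∨-introˡ (tsEdge-sound e)

  vertexAt : ∀ {x} → x ≤ 3 * m → Vertex (tripleStar m)
  vertexAt x≤3m = fromℕ< (≤-trans (s≤s x≤3m) (≤-reflexive (+-comm 1 (3 * m))))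

  toℕ-vertexAt : ∀ {x} (x≤3m : x ≤ 3 * m) → toℕ (vertexAt x≤3m) ≡ x
  toℕ-vertexAt _ = Finₚ.toℕ-fromℕ< _

  toℕ-≤ : (u : Vertex (tripleStar m)) → toℕ u ≤ 3 * m
  toℕ-≤ u = ≤-pred (≤-trans (Finₚ.toℕ<n u) (≤-reflexive (+-comm (3 * m) 1)))

  ts-noIsolatedVertex : 1 ≤ m → NoIsolatedVertex (tripleStar m)
  ts-noIsolatedVertex 1≤m u with toℕ u ℕ.≟ 0 | toℕ u ≤? 2 * m
  ... | yes u≡0 | _ =
    vertexAt 1≤3m , ts-adj-at (spoke ≤-refl 1≤m) u≡0 (toℕ-vertexAt 1≤3m)
    where 1≤3m = ≤-trans 1≤m (m≤m+n m (2 * m))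
  ... | no u≢0 | yes u≤2m =
    vertexAt u+m≤3m , ts-adj-at (leg (n≢0⇒n>0 u≢0) u≤2m) refl (toℕ-vertexAt u+m≤3m)
    where u+m≤3m = ≤-trans (+-monoˡ-≤ m u≤2m) (≤-reflexive (+-comm (2 * m) m))
  ... | no _ | no u≰2m =
    v , trans (ts-symmetric u v) (ts-adj-at {v} {u} (leg 1≤u∸m u∸m≤2m) (toℕ-vertexAt u∸m≤3m) (sym (m∸n+n≡m m≤u)))
    where
    1+m≤u : 1 + m ≤ toℕ u
    1+m≤u = ≤-trans (s≤s (m≤m+n m (m + 0))) (≰⇒> u≰2m)
    m≤u = ≤-trans (n≤1+n m) 1+m≤u
    1≤u∸m = m+n≤o⇒m≤o∸n 1 1+m≤u
    u∸m≤2m : toℕ u ∸ m ≤ 2 * m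
    u∸m≤2m = ≤-trans (∸-monoˡ-≤ m (toℕ-≤ u)) (≤-reflexive (m+n∸m≡n m (2 * m)))
    u∸m≤3m = ≤-trans u∸m≤2m (m≤n+m (2 * m) m)
    v = vertexAt u∸m≤3m

  -- The side of the bipartition containing the centre and the bᵢ.
  tsSide : ℕ → Bool
  tsSide x = (x == 0) ∨ ((suc m ≤ᵇ x) ∧ (x ≤ᵇ 2 * m))

  tsSide-positive : ∀ {x} → 1 ≤ x → tsSide x ≡ ((suc m ≤ᵇ x) ∧ (x ≤ᵇ 2 * m))
  tsSide-positive {suc x} _ = refl

  tsSide-low : ∀ {x} → 1 ≤ x → x ≤ m → tsSide x ≡ false
  tsSide-low {x} 1≤x x≤m =
    trans (tsSide-positive 1≤x) (cong (_∧ (x ≤ᵇ 2 * m)) (dec-false (suc m ≤? x) (≤⇒≯ x≤m)))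

  tsSide-middle : ∀ {x} → m < x → x ≤ 2 * m → tsSide x ≡ true
  tsSide-middle {x} m<x x≤2m =
    trans (tsSide-positive (≤-trans (s≤s z≤n) m<x))
          (cong₂ _∧_ (dec-true (suc m ≤? x) m<x) (dec-true (x ≤? 2 * m) x≤2m))

  tsSide-high : ∀ {x} → 2 * m < x → tsSide x ≡ false
  tsSide-high {x} 2m<x =
    trans (tsSide-positive (≤-trans (s≤s z≤n) 2m<x))
          (trans (cong ((suc m ≤ᵇ x) ∧_) (dec-false (x ≤? 2 * m) (<⇒≱ 2m<x))) (Boolₚ.∧-zeroʳ _))

  TsEdge-sides : ∀ {x y} → TsEdge m x y → tsSide x ≢ tsSide y
  TsEdge-sides (spoke 1≤y y≤m) eq = true≢false (trans eq (tsSide-low 1≤y y≤m))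
  TsEdge-sides (leg {x} 1≤x x≤2m) eq with x ≤? m
  ... | yes x≤m = true≢false (trans (sym (tsSide-middle m<x+m x+m≤2m)) (trans (sym eq) (tsSide-low 1≤x x≤m)))
    where m<x+m = ≤-trans (s≤s (m≤n+m m 0)) (+-monoˡ-≤ m 1≤x)
          x+m≤2m = ≤-trans (+-monoˡ-≤ m x≤m) (≤-reflexive (cong (m +_) (sym (+-identityʳ m))))
  ... | no  x≰m = true≢false (trans (sym (tsSide-middle (≰⇒> x≰m) x≤2m)) (trans eq (tsSide-high 2m<x+m)))
    where 2m<x+m = ≤-trans (≤-reflexive (cong (λ z → suc (m + z)) (+-identityʳ m))) (+-monoˡ-≤ m (≰⇒> x≰m))

  tsColour : Vertex (tripleStar m) → Fin 2
  tsColour = bit ∘ tsSide ∘ toℕ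

  tsColour-proper : Proper (tripleStar m) tsColour
  tsColour-proper u v u~v eq with ts-adj⁻¹ u v u~v
  ... | inj₁ e = TsEdge-sides e (bit-injective eq)
  ... | inj₂ e = TsEdge-sides e (sym (bit-injective eq))

  centre : Vertex (tripleStar m)
  centre = vertexAt z≤n

  vertexA : Fin m → Vertex (tripleStar m)
  vertexA i = vertexAt (≤-trans (Finₚ.toℕ<n i) (m≤m+n m (2 * m)))

  toℕ-vertexA : ∀ i → toℕ (vertexA i) ≡ suc (toℕ i)
  toℕ-vertexA i = Finₚ.toℕ-fromℕ< _

  vertexA-injective : Injective _≡_ _≡_ vertexA
  vertexA-injective {i} {j} eq =
    Finₚ.toℕ-injective (suc-injective (trans (sym (toℕ-vertexA i)) (trans (cong toℕ eq) (toℕ-vertexA j))))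

  centre~vertexA : ∀ i → adj (tripleStar m) centre (vertexA i) ≡ true
  centre~vertexA i = ts-adj-at (spoke (s≤s z≤n) (Finₚ.toℕ<n i)) (toℕ-vertexAt z≤n) (toℕ-vertexA i)

  module _ (1≤m : 1 ≤ m) where

    vertexB₁ : Vertex (tripleStar m)
    vertexB₁ = vertexAt (≤-trans (+-monoˡ-≤ m 1≤m) (+-monoʳ-≤ m (m≤m+n m (m + 0))))

    vertexC₁ : Vertex (tripleStar m)
    vertexC₁ = vertexAt (≤-trans (+-monoˡ-≤ (m + m) 1≤m) (≤-reflexive (cong (λ z → m + (m + z)) (sym (+-identityʳ m)))))

    toℕ-vertexB₁ : toℕ vertexB₁ ≡ suc m
    toℕ-vertexB₁ = Finₚ.toℕ-fromℕ< _

    toℕ-vertexC₁ : toℕ vertexC₁ ≡ suc m + m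
    toℕ-vertexC₁ = Finₚ.toℕ-fromℕ< _

    vertexC₁-pendant : ∀ {h} → adj (tripleStar m) vertexC₁ h ≡ true → h ≡ vertexB₁
    vertexC₁-pendant {h} c~h =
      Finₚ.toℕ-injective (trans (only-neighbour toℕ-vertexC₁ (ts-adj⁻¹ vertexC₁ h c~h)) (sym toℕ-vertexB₁))
      where
      2m≡m+m : 2 * m ≡ m + m
      2m≡m+m = cong (m +_) (+-identityʳ m)
      only-neighbour : ∀ {x y} → x ≡ suc m + m → TsEdge m x y ⊎ TsEdge m y x → y ≡ suc m
      only-neighbour ()  (inj₁ (spoke _ _))
      only-neighbour eq  (inj₁ (leg _ x≤2m))    =
        contradiction (≤-trans (≤-reflexive (sym eq)) (≤-trans x≤2m (≤-reflexive 2m≡m+m))) 1+n≰n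
      only-neighbour eq  (inj₂ (spoke _ x≤m))   =
        contradiction (≤-trans (≤-reflexive (sym eq)) (≤-trans x≤m (m≤m+n m m))) 1+n≰n
      only-neighbour eq  (inj₂ (leg {y} _ _))   = +-cancelʳ-≡ m y (suc m) eq

-- The graph P_l[K_{1,m,m,m}]

1*n+1≡1+n : ∀ n → 1 * n + 1 ≡ suc n
1*n+1≡1+n = solve-∀

Γ : ℕ → ℕ → Graph
Γ l m = lex (path l) (tripleStar m)

Γ-irreflexive : ∀ {l m} → Irreflexive (Γ l m)
Γ-irreflexive {l} {m} = lex-irreflexive {path l} {tripleStar m} path-irreflexive (ts-irreflexive {m})

id-dynamic : ∀ {l m r} → IsRDynamicColouring (Γ l m) r (l * (3 * m + 1)) id
id-dynamic {l} {m} {r} = locallyInjective⇒dynamic id (id-proper (Γ-irreflexive {l} {m})) (λ _ _ _ eq → eq) r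

module _ {l m : ℕ} (1≤m : 1 ≤ m) where

  private
    N = 3 * m + 1
    G′ = Γ (suc (suc l)) m
    first second : Fin (suc (suc l))
    first  = 0F
    second = 1F

  Γ-deg-≥ : ∀ v → suc N ≤ deg G′ v
  Γ-deg-≥ v = at (lexView {suc (suc l)} {N} v)
    where
    at : ∀ {v} → LexView v → suc N ≤ deg G′ v
    at ⟨ g , h ⟩ =
      let g′ , g~g′ = path-noIsolatedVertex g ; h′ , h~h′ = ts-noIsolatedVertex 1≤m h in
      subst (_≤ deg G′ (combine g h)) (1*n+1≡1+n N)
        (lex-deg-≥ {path (suc (suc l))} {tripleStar m} path-irreflexive (g′ ∷ []) (h′ ∷ [])
                   (λ { 0F → g~g′ }) singleton-injective (λ { 0F → h~h′ }) singleton-injective)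

  Γ-minDeg-≥ : suc N ≤ minDeg G′
  Γ-minDeg-≥ = ≤-minF (deg G′) (combine first (centre {m})) Γ-deg-≥

  Γ-deg-first-leaf-≤ : deg G′ (combine first (vertexC₁ 1≤m)) ≤ suc N
  Γ-deg-first-leaf-≤ =
    subst (deg G′ (combine first (vertexC₁ 1≤m)) ≤_) (1*n+1≡1+n N)
      (lex-deg-≤ {path (suc (suc l))} {tripleStar m} {g = first} {vertexC₁ 1≤m} (second ∷ []) (vertexB₁ 1≤m ∷ [])
        (λ g′ 0~g′ → 0F , sym (path-start-neighbour 0~g′))
        (λ h′ c~h′ → 0F , sym (vertexC₁-pendant 1≤m c~h′)))

  Γ-lowerBound : ∀ {r k a b} → HasRDynamicColouring G′ r k →
                 a ≤ r → a ≤ deg G′ (combine first (vertexC₁ 1≤m)) →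
                 b ≤ r → b ≤ deg G′ (combine second (vertexC₁ 1≤m)) → a + b ≤ k + 2
  Γ-lowerBound {r} (c , proper , dynamic) a≤r a≤d₀ b≤r b≤d₁ =
    ≤-trans (+-mono-≤ (≤-trans (⊓-glb a≤r a≤d₀) (dynamic (combine first (vertexC₁ 1≤m))))
                      (≤-trans (⊓-glb b≤r b≤d₁) (dynamic (combine second (vertexC₁ 1≤m)))))
            (pendant-bound {path (suc (suc l))} {tripleStar m} c proper {first} {second}
                           (λ {a} {a′} → path-start-joined {a = a} {a′}) {vertexC₁ 1≤m} {vertexB₁ 1≤m}
                           (vertexC₁-pendant 1≤m))

  Γ-≥2N : ∀ {r k} → suc N ≤ r → HasRDynamicColouring G′ r k → 2 * N ≤ k
  Γ-≥2N {r} {k} N<r colouring = +-cancelʳ-≤ 2 (2 * N) k (begin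
    2 * N + 2            ≡⟨ rearrange N ⟩
    suc N + suc N        ≤⟨ Γ-lowerBound colouring N<r (Γ-deg-≥ _) N<r (Γ-deg-≥ _) ⟩
    k + 2                ∎)
    where
    open ≤-Reasoning
    rearrange : ∀ n → 2 * n + 2 ≡ suc n + suc n
    rearrange = solve-∀

  Γ-χ≡4 : ∀ {r} → r ≤ 3 → ChiR≡ G′ r 4
  Γ-χ≡4 r≤3 =
    ((parity ∘ toℕ {suc (suc l)}) ⊗ tsColour {m} ,
     ⊗-dynamic {path (suc (suc l))} {tripleStar m} (path-noIsolatedVertex {l}) (ts-noIsolatedVertex 1≤m)
               (parity-proper {suc (suc l)}) (tsColour-proper {m}) spokeEdge
               (clique-injective spokeEdge (tsColour {m}) spokeEdge-clique (tsColour-proper {m})) r≤3) ,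
    λ k′ k′<4 colouring → <⇒≱ k′<4 (clique⇒≤colours K₄ K₄-clique colouring)
    where
    spokeEdge : Fin 2 → Vertex (tripleStar m)
    spokeEdge = centre {m} ∷ vertexA (fromℕ< 1≤m) ∷ []
    spokeEdge-clique : IsClique (tripleStar m) spokeEdge
    spokeEdge-clique = edge-clique (ts-symmetric {m}) (centre~vertexA (fromℕ< 1≤m))
    K₄ : Fin (2 * 2) → Vertex G′
    K₄ = (first ∷ second ∷ []) ⊗ spokeEdge
    K₄-clique : IsClique G′ K₄
    K₄-clique = lex-clique {path (suc (suc l))} {tripleStar m} {e₁ = first ∷ second ∷ []} {spokeEdge}
                (edge-clique path-symmetric {first} {second} refl) spokeEdge-clique

  Γ-χ-middle : ∀ {r} → 4 ≤ r → r + 1 ≤ minDeg G′ → ∃ λ i → 2 ≤ i × ChiR≡ G′ r (r + i)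
  Γ-χ-middle {r} 4≤r r<δ = χ-≥ (id , id-dynamic {suc (suc l)} {m}) lower
    where
    r≤deg : ∀ v → r ≤ deg G′ v
    r≤deg v = ≤-trans (m≤m+n r 1) (≤-trans r<δ (minF-≤ (deg G′) v))
    rearrange : ∀ n → 2 + n + 2 ≡ n + 4
    rearrange = solve-∀
    lower : ∀ {k} → HasRDynamicColouring G′ r k → 2 + r ≤ k
    lower {k} colouring = +-cancelʳ-≤ 2 (2 + r) k (begin
      2 + r + 2   ≡⟨ rearrange r ⟩
      r + 4       ≤⟨ +-monoʳ-≤ r 4≤r ⟩
      r + r       ≤⟨ Γ-lowerBound colouring ≤-refl (r≤deg _) ≤-refl (r≤deg _) ⟩
      k + 2       ∎)
      where open ≤-Reasoning

Γ₂-χ : ∀ {m r} → 1 ≤ m → minDeg (Γ 2 m) ≤ r → ChiR≡ (Γ 2 m) r (2 * (3 * m + 1))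
Γ₂-χ {m} 1≤m δ≤r =
  (id , id-dynamic {2} {m}) ,
  λ k′ k′<2N colouring → <⇒≱ k′<2N (Γ-≥2N {l = 0} 1≤m (≤-trans (Γ-minDeg-≥ 1≤m) δ≤r) colouring)

module _ {l m : ℕ} (1≤m : 1 ≤ m) where

  private
    N = 3 * m + 1
    G″ = Γ (suc (suc (suc l))) m
    first second third : Fin (suc (suc (suc l)))
    first  = 0F
    second = 1F
    third  = 2F
    outer : Fin 2 → Fin (suc (suc (suc l)))
    outer = first ∷ third ∷ []

  Γ-deg-second-≥ : ∀ {b h} (e : Fin b → Vertex (tripleStar m)) →
                   (∀ j → adj (tripleStar m) h (e j) ≡ true) → Injective _≡_ _≡_ e →
                   2 * N + b ≤ deg G″ (combine second h)
  Γ-deg-second-≥ {h = h} e h~e e-inj =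
    lex-deg-≥ {path (suc (suc (suc l)))} {tripleStar m} path-irreflexive {g = second} {h} outer e
      (λ { 0F → refl ; 1F → refl }) (pair-injective λ ()) h~e e-inj

  Γ-deg-second-leaf-≥ : 2 * N + 1 ≤ deg G″ (combine second (vertexC₁ 1≤m))
  Γ-deg-second-leaf-≥ = Γ-deg-second-≥ (vertexB₁ 1≤m ∷ []) (λ { 0F → c~b }) singleton-injective
    where
    1+m≤2m : 1 + m ≤ 2 * m
    1+m≤2m = ≤-trans (+-monoˡ-≤ m 1≤m) (≤-reflexive (cong (m +_) (sym (+-identityʳ m))))
    c~b : adj (tripleStar m) (vertexC₁ 1≤m) (vertexB₁ 1≤m) ≡ true
    c~b = trans (ts-symmetric {m} (vertexC₁ 1≤m) (vertexB₁ 1≤m))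
                (ts-adj-at {m} (leg (s≤s z≤n) 1+m≤2m) (toℕ-vertexB₁ 1≤m) (toℕ-vertexC₁ 1≤m))

  Γ-maxDeg-≥ : 2 * N + m ≤ maxDeg G″
  Γ-maxDeg-≥ = ≤-trans (Γ-deg-second-≥ vertexA centre~vertexA vertexA-injective)
                       (≤-maxF (deg G″) (combine second (centre {m})))

  Γ-χ-at-δ : ∀ {r} → r ≡ minDeg G″ → ChiR≡ G″ r (2 * N)
  Γ-χ-at-δ refl =
    ((parity ∘ toℕ {suc (suc (suc l))}) ⊗ id {A = Fin N} ,
     ⊗-dynamic {path (suc (suc (suc l)))} {tripleStar m} (path-noIsolatedVertex {suc l}) (ts-noIsolatedVertex 1≤m)
               (parity-proper {suc (suc (suc l))}) (id-proper (ts-irreflexive {m})) id id δ≤1+N) ,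
    λ k′ k′<2N colouring → <⇒≱ k′<2N (Γ-≥2N 1≤m (Γ-minDeg-≥ 1≤m) colouring)
    where δ≤1+N = ≤-trans (minF-≤ (deg G″) (combine first (vertexC₁ 1≤m))) (Γ-deg-first-leaf-≤ 1≤m)

  Γ-χ-above-δ : ∀ {r} → minDeg G″ + 1 ≤ r → ∃ λ i → 1 ≤ i × ChiR≡ G″ r (2 * N + i)
  Γ-χ-above-δ {r} δ<r = χ-≥ (id , id-dynamic {suc (suc (suc l))} {m}) lower
    where
    N+2≤r : suc N + 1 ≤ r
    N+2≤r = ≤-trans (+-monoˡ-≤ 1 (Γ-minDeg-≥ 1≤m)) δ<r
    N<r : suc N ≤ r
    N<r = ≤-trans (m≤m+n (suc N) 1) N+2≤r
    N+2≤2N+1 : suc N + 1 ≤ 2 * N + 1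
    N+2≤2N+1 = +-monoˡ-≤ 1 (≤-trans (+-monoˡ-≤ N (m≤n+m 1 (3 * m))) (≤-reflexive (cong (N +_) (sym (+-identityʳ N)))))
    rearrange : ∀ n → 1 + 2 * n + 2 ≡ suc n + (suc n + 1)
    rearrange = solve-∀
    lower : ∀ {k} → HasRDynamicColouring G″ r k → 1 + 2 * N ≤ k
    lower {k} colouring = +-cancelʳ-≤ 2 (1 + 2 * N) k (begin
      1 + 2 * N + 2         ≡⟨ rearrange N ⟩
      suc N + (suc N + 1)   ≤⟨ Γ-lowerBound 1≤m colouring N<r (Γ-deg-≥ 1≤m _)
                                                  N+2≤r (≤-trans N+2≤2N+1 Γ-deg-second-leaf-≥) ⟩
      k + 2                 ∎)
      where open ≤-Reasoning

  Γ-χ-top : ∀ {r} → maxDeg G″ + 2 ≤ r + m → ChiR≡ G″ r (3 * N)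
  Γ-χ-top {r} Δ<r+m =
    ((residue3 ∘ toℕ {suc (suc (suc l))}) ⊗ id {A = Fin N} ,
     locallyInjective⇒dynamic _
       (⊗-proper {path (suc (suc (suc l)))} {tripleStar m} residue3-proper (id-proper (ts-irreflexive {m})))
       (⊗-locallyInjective {path (suc (suc (suc l)))} {tripleStar m} residue3-closedInjective id) r) ,
    λ k′ k′<3N colouring → <⇒≱ k′<3N (lower colouring)
    where
    shift : ∀ n m → 2 * n + m + 2 ≡ 2 * n + 2 + m
    shift = solve-∀
    2N+2≤r : 2 * N + 2 ≤ r
    2N+2≤r = +-cancelʳ-≤ m (2 * N + 2) r
               (≤-trans (≤-reflexive (sym (shift N m))) (≤-trans (+-monoˡ-≤ 2 Γ-maxDeg-≥) Δ<r+m))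
    rearrange : ∀ n → 3 * n + 2 ≡ suc n + (2 * n + 1)
    rearrange = solve-∀
    lower : ∀ {k} → HasRDynamicColouring G″ r k → 3 * N ≤ k
    lower {k} colouring = +-cancelʳ-≤ 2 (3 * N) k (begin
      3 * N + 2              ≡⟨ rearrange N ⟩
      suc N + (2 * N + 1)    ≤⟨ Γ-lowerBound 1≤m colouring N<r (Γ-deg-≥ 1≤m _) 2N<r Γ-deg-second-leaf-≥ ⟩
      k + 2                  ∎)
      where
      open ≤-Reasoning
      2N<r = ≤-trans (+-monoʳ-≤ (2 * N) (n≤1+n 1)) 2N+2≤r
      N<r  = ≤-trans (≤-trans (≤-reflexive (+-comm 1 N)) (+-monoˡ-≤ 1 (m≤m+n N (N + 0)))) 2N<r

theorem4 : (r l m : ℕ) → 1 ≤ r → 2 ≤ l → 3 ≤ m →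
    let G = lex (path l) (tripleStar m)
        δ = minDeg G
        Δ = maxDeg G
    in (r ≤ 3 → ChiR≡ G r 4)
     × (4 ≤ r → r + 1 ≤ δ → ∃ λ i → 2 ≤ i × ChiR≡ G r (r + i))
     × (l ≡ 2 → δ ≤ r → r ≤ Δ → ChiR≡ G r (2 * (3 * m + 1)))
     × (l ≢ 2 → r ≡ δ → ChiR≡ G r (2 * (3 * m + 1)))
     × (l ≢ 2 → δ + 1 ≤ r → r + m ≤ Δ + 1 →
          ∃ λ i → 1 ≤ i × ChiR≡ G r (2 * (3 * m + 1) + i))
     × (3 ≤ l → Δ + 2 ≤ r + m → r ≤ Δ → ChiR≡ G r (3 * (3 * m + 1)))
theorem4 r (suc (suc l)) m _ (s≤s (s≤s z≤n)) 3≤m =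
  Γ-χ≡4 1≤m , Γ-χ-middle 1≤m , part-iii l , part-iv l , part-v l , part-vi l
  where
  1≤m : 1 ≤ m
  1≤m = ≤-trans (s≤s z≤n) 3≤m
  part-iii : ∀ l → suc (suc l) ≡ 2 → minDeg (Γ (suc (suc l)) m) ≤ r → r ≤ maxDeg (Γ (suc (suc l)) m) →
             ChiR≡ (Γ (suc (suc l)) m) r (2 * (3 * m + 1))
  part-iii zero _ δ≤r _ = Γ₂-χ 1≤m δ≤r
  part-iv : ∀ l → suc (suc l) ≢ 2 → r ≡ minDeg (Γ (suc (suc l)) m) → ChiR≡ (Γ (suc (suc l)) m) r (2 * (3 * m + 1))
  part-iv zero    l≢2 _   = contradiction refl l≢2
  part-iv (suc l) _   r≡δ = Γ-χ-at-δ 1≤m r≡δ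
  part-v : ∀ l → suc (suc l) ≢ 2 → minDeg (Γ (suc (suc l)) m) + 1 ≤ r → r + m ≤ maxDeg (Γ (suc (suc l)) m) + 1 →
           ∃ λ i → 1 ≤ i × ChiR≡ (Γ (suc (suc l)) m) r (2 * (3 * m + 1) + i)
  part-v zero    l≢2 _   _ = contradiction refl l≢2
  part-v (suc l) _   δ<r _ = Γ-χ-above-δ 1≤m δ<r
  part-vi : ∀ l → 3 ≤ suc (suc l) → maxDeg (Γ (suc (suc l)) m) + 2 ≤ r + m → r ≤ maxDeg (Γ (suc (suc l)) m) →
            ChiR≡ (Γ (suc (suc l)) m) r (3 * (3 * m + 1))
  part-vi zero    (s≤s (s≤s ()))
  part-vi (suc l) _ Δ<r+m _ = Γ-χ-top 1≤m Δ<r+m
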